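{- Let $M$ be a matroid, let $S,T$ be disjoint subsets of $E(M)$, let $k := \kappa_M(S,T)$, and let $U\subseteq E(M)$ be $S$-$T$-separating of order $k+1$. If $e \in E(M)- (T\cup U)$ satisfies $\kappa_{M/e}(S,T)\neq \kappa_M(S,T)$, then $\kappa_{M/e}(U,T)\neq\kappa_M(U,T)$.
   Context: For a matroid $M$ with ground set $E$, $\lambda_M(X) := r_M(X) + r_M(E- X) - r(M)$, and for disjoint $S,T\subseteq E$, $\kappa_M(S,T) := \min\{\lambda_M(X) : S \subseteq X \subseteq E- T\}$. A set $U$ is $S$-$T$-separating of order $k+1$ if $S\subseteq U$, $U\cap T=\emptyset$ and $\lambda_M(U)=k$. -}

module Defs where

open import Data.Nat using (ℕ; _+_; _∸_; _≤_; _⊓_)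
open import Data.Bool using (true; false)
open import Data.Vec using ([]; _∷_)
open import Data.List using (List; []; _∷_; _++_; map; foldr)
open import Data.Maybe using (Maybe; just; nothing; fromMaybe)
open import Data.Fin using (Fin)
open import Data.Fin.Subset using (Subset; _⊆_; _∩_; _∪_; _─_; _-_; ∁; ⁅_⁆; ∣_∣; Empty; _∉_)
open import Data.Fin.Subset.Properties using (_⊆?_)
open import Relation.Nullary using (yes; no)

-- A "rank data" on the finite universe Fin n: a ground set E ⊆ Fin n
-- together with a function r on subsets (only its values on subsets of E matter).
record RankData (n : ℕ) : Set where
  constructor mkRankData
  field
    E : Subset n
    r : Subset n → ℕ

open RankData public

record IsMatroid {n : ℕ} (M : RankData n) : Set where
  field
    r-bound : ∀ X → X ⊆ E M → r M X ≤ ∣ X ∣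
    r-mono  : ∀ X Y → X ⊆ Y → Y ⊆ E M → r M X ≤ r M Y
    r-submod : ∀ X Y → X ⊆ E M → Y ⊆ E M →
               r M (X ∪ Y) + r M (X ∩ Y) ≤ r M X + r M Y

rk : ∀ {n} → RankData n → ℕ
rk M = r M (E M)

-- connectivity function λ_M(X) = r(X) + r(E - X) - r(M)
-- (truncated subtraction; for a matroid r(X)+r(E-X) ≥ r(M) so no truncation occurs)
lam : ∀ {n} → RankData n → Subset n → ℕ
lam M X = (r M X + r M (E M ─ X)) ∸ rk M

contract : ∀ {n} → RankData n → Fin n → RankData n
contract M e = mkRankData (E M - e) (λ X → r M (X ∪ ⁅ e ⁆) ∸ r M ⁅ e ⁆)

allSubsets : ∀ n → List (Subset n)
allSubsets ℕ.zero = [] ∷ []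
allSubsets (ℕ.suc n) = map (false ∷_) (allSubsets n) ++ map (true ∷_) (allSubsets n)

private
  minMaybe : Maybe ℕ → ℕ → Maybe ℕ
  minMaybe nothing  k = just k
  minMaybe (just m) k = just (m ⊓ k)

kappaMaybe : ∀ {n} → RankData n → Subset n → Subset n → Maybe ℕ
kappaMaybe {n} M S T = foldr step nothing (allSubsets n)
  where
  step : Subset n → Maybe ℕ → Maybe ℕ
  step X acc with S ⊆? X | X ⊆? (E M ─ T)
  ... | yes _ | yes _ = minMaybe acc (lam M X)
  ... | _     | _     = acc

-- κ_M(S,T) = min { λ_M(X) : S ⊆ X ⊆ E - T }
-- (junk value 0 only when the range is empty, which never happens for
--  disjoint S, T ⊆ E, the only case used)
kappa : ∀ {n} → RankData n → Subset n → Subset n → ℕ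
kappa M S T = fromMaybe 0 (kappaMaybe M S T)

IsSTSeparatingOfOrder : ∀ {n} → RankData n → Subset n → Subset n → Subset n → ℕ → Set
IsSTSeparatingOfOrder M S T U k1 = S ⊆ U × Empty (U ∩ T) × (ℕ.suc (lam M U) ≡ k1)
  where
  open import Data.Product using (_×_)
  open import Relation.Binary.PropositionalEquality using (_≡_)

module Submission where

-- For e ∉ Y, contracting e lowers λ(Y) by r(Y) + r(e) − r(Y ∪ e) ∈ {0, 1}: it drops exactly
-- when Y and {e} are not skew, a property inherited by supersets of Y. Since U is an S-T set
-- with λ(U) = k not containing e, κ_{M/e}(S,T) < k, and a minimiser X of κ_{M/e}(S,T) has
-- λ_M(X) = k and is not skew to {e}. Uncrossing X with U (submodularity of λ, with X ∩ U
-- again S-T-separating) gives λ_M(X ∪ U) ≤ k, and then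
-- κ_{M/e}(U,T) ≤ λ_{M/e}(X ∪ U) < λ_M(X ∪ U) ≤ k ≤ κ_M(U,T).

open import Defs
open import Data.Nat using (ℕ; suc; _+_; _∸_; _≤_; _<_)
open import Data.Nat.Properties hiding (_≟_)
open import Data.Nat.Tactic.RingSolver using (solve-∀)
open import Data.Fin using (Fin)
open import Data.Fin.Properties using (_≟_)
open import Data.Fin.Subset
open import Data.Fin.Subset.Properties
open import Data.List using (List; []; _∷_; foldr; map)
open import Data.List.Membership.Propositional using () renaming (_∈_ to _∈ˡ_)
open import Data.List.Membership.Propositional.Properties using (∈-map⁺; ∈-++⁺ˡ; ∈-++⁺ʳ)
open import Data.List.Relation.Unary.Any using (here; there)
open import Data.Maybe using (Maybe; just; nothing; fromMaybe)
open import Data.Maybe.Relation.Unary.All using (All; just; nothing)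
open import Data.Maybe.Relation.Unary.Any using (Any; just)
open import Data.Product using (∃; _×_; _,_)
open import Data.Sum using (inj₁; inj₂; [_,_]′)
open import Data.Vec using ([]; _∷_; here; there)
open import Function using (_∘_; _⇔_; mk⇔; Equivalence)
open import Relation.Nullary using (yes; no)
open import Data.Empty using (⊥-elim)
open import Relation.Binary.PropositionalEquality
open import Algebra.Properties.CommutativeSemigroup +-commutativeSemigroup
  using () renaming (interchange to +-interchange)

x∈p─q⇒x∉q : ∀ {n} {x : Fin n} (p q : Subset n) → x ∈ p ─ q → x ∉ q
x∈p─q⇒x∉q (_ ∷ p) (outside ∷ q) here      ()
x∈p─q⇒x∉q (_ ∷ p) (_       ∷ q) (there x) (there y) = x∈p─q⇒x∉q p q x y

∪-lub : ∀ {n} {p q r : Subset n} → p ⊆ r → q ⊆ r → p ∪ q ⊆ r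
∪-lub {p = p} {q} p⊆r q⊆r x = [ p⊆r , q⊆r ]′ (x∈p∪q⁻ p q x)

∩-glb : ∀ {n} {p q r : Subset n} → p ⊆ q → p ⊆ r → p ⊆ q ∩ r
∩-glb p⊆q p⊆r x = x∈p∩q⁺ (p⊆q x , p⊆r x)

x∈p⇒⁅x⁆⊆p : ∀ {n} {x : Fin n} {p : Subset n} → x ∈ p → ⁅ x ⁆ ⊆ p
x∈p⇒⁅x⁆⊆p {x = x} {p} x∈p y∈⁅x⁆ = subst (_∈ p) (sym (x∈⁅y⁆⇒x≡y x y∈⁅x⁆)) x∈p

q⊆p∪q─p : ∀ {n} (p q : Subset n) → q ⊆ p ∪ (q ─ p)
q⊆p∪q─p p q {x} x∈q with x ∈? p
... | yes x∈p = x∈p∪q⁺ (inj₁ x∈p)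
... | no  x∉p = x∈p∪q⁺ (inj₂ (x∈p∧x∉q⇒x∈p─q x∈q x∉p))

p─q∩r⊆p─q∪p─r : ∀ {n} (p q r : Subset n) → p ─ (q ∩ r) ⊆ (p ─ q) ∪ (p ─ r)
p─q∩r⊆p─q∪p─r p q r {x} x∈ with x ∈? q
... | yes x∈q = x∈p∪q⁺ (inj₂ (x∈p∧x∉q⇒x∈p─q x∈p (λ x∈r → x∉q∩r (x∈p∩q⁺ (x∈q , x∈r)))))
  where x∈p = p─q⊆p p (q ∩ r) x∈
        x∉q∩r = x∈p─q⇒x∉q p (q ∩ r) x∈
... | no  x∉q = x∈p∪q⁺ (inj₁ (x∈p∧x∉q⇒x∈p─q (p─q⊆p p (q ∩ r) x∈) x∉q))

p─q∪r⊆p─q∩p─r : ∀ {n} (p q r : Subset n) → p ─ (q ∪ r) ⊆ (p ─ q) ∩ (p ─ r)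
p─q∪r⊆p─q∩p─r p q r x∈ = x∈p∩q⁺ (x∈p∧x∉q⇒x∈p─q x∈p (x∉q∪r ∘ x∈p∪q⁺ ∘ inj₁) ,
                                 x∈p∧x∉q⇒x∈p─q x∈p (x∉q∪r ∘ x∈p∪q⁺ ∘ inj₂))
  where x∈p = p─q⊆p p (q ∪ r) x∈
        x∉q∪r = x∈p─q⇒x∉q p (q ∪ r) x∈

p-x∪⁅x⁆≡p : ∀ {n} {x : Fin n} {p : Subset n} → x ∈ p → (p - x) ∪ ⁅ x ⁆ ≡ p
p-x∪⁅x⁆≡p {x = x} {p} x∈p = ⊆-antisym (∪-lub (p─q⊆p p ⁅ x ⁆) (x∈p⇒⁅x⁆⊆p x∈p)) p⊆p-x∪⁅x⁆
  where
  p⊆p-x∪⁅x⁆ : p ⊆ (p - x) ∪ ⁅ x ⁆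
  p⊆p-x∪⁅x⁆ {y} y∈p with y ≟ x
  ... | yes refl = x∈p∪q⁺ (inj₂ (x∈⁅x⁆ x))
  ... | no  y≢x  = x∈p∪q⁺ (inj₁ (x∈p∧x≢y⇒x∈p-y y∈p y≢x))

allSubsets-complete : ∀ n (X : Subset n) → X ∈ˡ allSubsets n
allSubsets-complete ℕ.zero    []          = here refl
allSubsets-complete (suc n) (outside ∷ X) = ∈-++⁺ˡ (∈-map⁺ (outside ∷_) (allSubsets-complete n X))
allSubsets-complete (suc n) (inside  ∷ X) =
  ∈-++⁺ʳ (map (outside ∷_) (allSubsets n)) (∈-map⁺ (inside ∷_) (allSubsets-complete n X))

record Separating {n} (M : RankData n) (S T X : Subset n) : Set where
  constructor separating
  field
    ⊇S    : S ⊆ X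
    ⊆E─T  : X ⊆ E M ─ T

module _ {n} (M : RankData n) (S T : Subset n) where

  -- The step function of kappaMaybe is local to its where block; unification recovers it.
  private
    foldr-step : ∀ {A B : Set} {f : A → B → B} {z : B} {L : List A} →
                 foldr f z L ≡ foldr f z L → A → B → B
    foldr-step {f = f} _ = f

    step : Subset n → Maybe ℕ → Maybe ℕ
    step = foldr-step {L = allSubsets n} (refl {x = kappaMaybe M S T})

    Attained : ℕ → Set
    Attained m = ∃ λ Z → Separating M S T Z × lam M Z ≡ m

    step-keeps-≤ : ∀ Y {k} acc → Any (_≤ k) acc → Any (_≤ k) (step Y acc)
    step-keeps-≤ Y acc m≤k with S ⊆? Y | Y ⊆? (E M ─ T)
    step-keeps-≤ Y (just m) (just m≤k) | yes _ | yes _ = just (≤-trans (m⊓n≤m m (lam M Y)) m≤k)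
    ... | yes _ | no  _ = m≤k
    ... | no  _ | _     = m≤k

    step-≤-lam : ∀ Y acc → Separating M S T Y → Any (_≤ lam M Y) (step Y acc)
    step-≤-lam Y acc (separating S⊆Y Y⊆E─T) with S ⊆? Y | Y ⊆? (E M ─ T)
    step-≤-lam Y nothing  _ | yes _ | yes _ = just ≤-refl
    step-≤-lam Y (just m) _ | yes _ | yes _ = just (m⊓n≤n m (lam M Y))
    ... | yes _   | no ¬Y⊆ = ⊥-elim (¬Y⊆ Y⊆E─T)
    ... | no ¬S⊆ | _       = ⊥-elim (¬S⊆ S⊆Y)

    step-attained : ∀ Y acc → All Attained acc → All Attained (step Y acc)
    step-attained Y acc att with S ⊆? Y | Y ⊆? (E M ─ T)
    step-attained Y nothing  _ | yes S⊆Y | yes Y⊆ = just (Y , separating S⊆Y Y⊆ , refl)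
    step-attained Y (just m) (just att) | yes S⊆Y | yes Y⊆ with ⊓-sel m (lam M Y)
    ... | inj₁ m⊓≡m = just (subst Attained (sym m⊓≡m) att)
    ... | inj₂ m⊓≡λ = just (Y , separating S⊆Y Y⊆ , sym m⊓≡λ)
    step-attained Y acc att | yes _ | no _ = att
    step-attained Y acc att | no _  | _    = att

    fold : List (Subset n) → Maybe ℕ
    fold = foldr step nothing

    fold-≤-lam : ∀ {X} L → X ∈ˡ L → Separating M S T X → Any (_≤ lam M X) (fold L)
    fold-≤-lam (Y ∷ L) (here refl) sep = step-≤-lam Y (fold L) sep
    fold-≤-lam (Y ∷ L) (there X∈L) sep = step-keeps-≤ Y (fold L) (fold-≤-lam L X∈L sep)

    fold-attained : ∀ L → All Attained (fold L)
    fold-attained []      = nothing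
    fold-attained (Y ∷ L) = step-attained Y (fold L) (fold-attained L)

    any-≤-fromMaybe : ∀ {k} {mx : Maybe ℕ} → Any (_≤ k) mx → fromMaybe 0 mx ≤ k
    any-≤-fromMaybe (just m≤k) = m≤k

    any-all-attained : ∀ {k} {mx : Maybe ℕ} → Any (_≤ k) mx → All Attained mx → Attained (fromMaybe 0 mx)
    any-all-attained (just _) (just att) = att

  kappa-≤-lam : ∀ {X} → Separating M S T X → kappa M S T ≤ lam M X
  kappa-≤-lam {X} sep = any-≤-fromMaybe (fold-≤-lam (allSubsets n) (allSubsets-complete n X) sep)

  kappa-attained : ∀ {X} → Separating M S T X →
                   ∃ λ Z → Separating M S T Z × lam M Z ≡ kappa M S T
  kappa-attained {X} sep =
    any-all-attained (fold-≤-lam (allSubsets n) (allSubsets-complete n X) sep)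
                     (fold-attained (allSubsets n))

module _ {n} {M : RankData n} where

  separating⇒⊆E : ∀ {S T X} → Separating M S T X → X ⊆ E M
  separating⇒⊆E (separating _ X⊆E─T) = p─q⊆p _ _ ∘ X⊆E─T

  separating-∩ : ∀ {S T X Y} → Separating M S T X → Separating M S T Y → Separating M S T (X ∩ Y)
  separating-∩ (separating S⊆X X⊆) (separating S⊆Y _) = separating (∩-glb S⊆X S⊆Y) (X⊆ ∘ p∩q⊆p _ _)

  separating-self : ∀ {S T U} → Separating M S T U → Separating M U T U
  separating-self (separating _ U⊆) = separating ⊆-refl U⊆

  separating-∪ : ∀ {S T X Y} → X ⊆ E M ─ T → Separating M S T Y → Separating M S T (X ∪ Y)
  separating-∪ X⊆ (separating S⊆Y Y⊆) = separating (⊆-trans S⊆Y (q⊆p∪q _ _)) (∪-lub X⊆ Y⊆)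

  disjoint⇒separating : ∀ {S T U} → S ⊆ U → U ⊆ E M → Empty (U ∩ T) → Separating M S T U
  disjoint⇒separating {T = T} S⊆U U⊆E U∩T≡∅ =
    separating S⊆U λ x∈U → x∈p∧x∉q⇒x∈p─q (U⊆E x∈U) (λ x∈T → U∩T≡∅ (_ , x∈p∩q⁺ (x∈U , x∈T)))

  module _ {e : Fin n} where

    separating-contract⁺ : ∀ {S T X} → Separating M S T X → e ∉ X → Separating (contract M e) S T X
    separating-contract⁺ {T = T} (separating S⊆X X⊆) e∉X = separating S⊆X λ x∈X →
      x∈p∧x∉q⇒x∈p─q (x∈p∧x≢y⇒x∈p-y (p─q⊆p _ T (X⊆ x∈X)) λ { refl → e∉X x∈X }) (x∈p─q⇒x∉q _ T (X⊆ x∈X))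

    separating-contract⁻ : ∀ {S T X} → Separating (contract M e) S T X → Separating M S T X × e ∉ X
    separating-contract⁻ {T = T} (separating S⊆X X⊆) =
      separating S⊆X (λ x∈X → x∈p∧x∉q⇒x∈p─q (p─q⊆p _ _ (p─q⊆p _ T (X⊆ x∈X))) (x∈p─q⇒x∉q _ T (X⊆ x∈X))) ,
      λ e∈X → x∈p─q⇒x∉q (E M) ⁅ e ⁆ (p─q⊆p _ T (X⊆ e∈X)) (x∈⁅x⁆ e)

kappa-mono : ∀ {n} (M : RankData n) {S S′ T W : Subset n} → S ⊆ S′ → Separating M S′ T W →
             kappa M S T ≤ kappa M S′ T
kappa-mono M {S} {S′} {T} S⊆S′ W-sep with kappa-attained M S′ T W-sep
... | Z , separating S′⊆Z Z⊆ , λZ≡κ = subst (kappa M S T ≤_) λZ≡κ (kappa-≤-lam M S T (separating (⊆-trans S⊆S′ S′⊆Z) Z⊆))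

[a∸c+b∸c]∸[d∸c]+d+c≡a+b : ∀ {a b c d} → c ≤ a → c ≤ b → c ≤ d → d + c ≤ a + b →
                           (a ∸ c + (b ∸ c)) ∸ (d ∸ c) + d + c ≡ a + b
[a∸c+b∸c]∸[d∸c]+d+c≡a+b {c = c} c≤a c≤b c≤d d+c≤a+b
  with m≤n⇒∃[o]m+o≡n c≤a | m≤n⇒∃[o]m+o≡n c≤b | m≤n⇒∃[o]m+o≡n c≤d
... | A , refl | B , refl | D , refl rewrite m+n∸m≡n c A | m+n∸m≡n c B | m+n∸m≡n c D = begin
  A + B ∸ D + (c + D) + c  ≡⟨ shuffle₁ (A + B ∸ D) D c ⟩
  (A + B ∸ D + D) + c + c  ≡⟨ cong (λ t → t + c + c) (m∸n+n≡m D≤A+B) ⟩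
  A + B + c + c            ≡⟨ shuffle₂ A B c ⟩
  c + A + (c + B)          ∎
  where
  open ≡-Reasoning
  shuffle₁ : ∀ x D c → x + (c + D) + c ≡ x + D + c + c
  shuffle₁ = solve-∀
  shuffle₂ : ∀ A B c → A + B + c + c ≡ c + A + (c + B)
  shuffle₂ = solve-∀
  shuffle₃ : ∀ D c → c + D + c ≡ D + (c + c)
  shuffle₃ = solve-∀
  shuffle₄ : ∀ A B c → c + A + (c + B) ≡ A + B + (c + c)
  shuffle₄ = solve-∀
  D≤A+B : D ≤ A + B
  D≤A+B = +-cancelʳ-≤ (c + c) D (A + B) (subst₂ _≤_ (shuffle₃ D c) (shuffle₄ A B c) d+c≤a+b)

NonSkew : ∀ {n} → RankData n → Subset n → Subset n → Set
NonSkew M X Y = r M (X ∪ Y) < r M X + r M Y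

module _ {n} {M : RankData n} (isMatroid : IsMatroid M) where
  open IsMatroid isMatroid

  r-submod-⊆ : ∀ {A B X Y} → X ⊆ E M → Y ⊆ E M → A ⊆ X ∪ Y → B ⊆ X ∩ Y →
               r M A + r M B ≤ r M X + r M Y
  r-submod-⊆ {X = X} {Y} X⊆E Y⊆E A⊆X∪Y B⊆X∩Y =
    ≤-trans (+-mono-≤ (r-mono _ _ A⊆X∪Y (∪-lub X⊆E Y⊆E)) (r-mono _ _ B⊆X∩Y (X⊆E ∘ p∩q⊆p X Y)))
            (r-submod X Y X⊆E Y⊆E)

  rk≤r+r-complement : ∀ {X} → X ⊆ E M → rk M ≤ r M X + r M (E M ─ X)
  rk≤r+r-complement {X} X⊆E =
    ≤-trans (m≤m+n (rk M) (r M (X ∩ (E M ─ X))))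
            (r-submod-⊆ X⊆E (p─q⊆p (E M) X) (q⊆p∪q─p X (E M)) ⊆-refl)

  lam+rk≡r+r-complement : ∀ {X} → X ⊆ E M → lam M X + rk M ≡ r M X + r M (E M ─ X)
  lam+rk≡r+r-complement X⊆E = m∸n+n≡m (rk≤r+r-complement X⊆E)

  lam-submodular : ∀ {X Y} → X ⊆ E M → Y ⊆ E M → lam M (X ∪ Y) + lam M (X ∩ Y) ≤ lam M X + lam M Y
  lam-submodular {X} {Y} X⊆E Y⊆E = +-cancelʳ-≤ (R + R) _ _ (begin
    (λ∪ + λ∩) + (R + R)                      ≡⟨ +-interchange λ∪ λ∩ R R ⟩
    (λ∪ + R) + (λ∩ + R)                      ≡⟨ cong₂ _+_ (lam+rk≡r+r-complement X∪Y⊆E) (lam+rk≡r+r-complement X∩Y⊆E) ⟩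
    (r M (X ∪ Y) + c∪) + (r M (X ∩ Y) + c∩)  ≡⟨ +-interchange (r M (X ∪ Y)) c∪ (r M (X ∩ Y)) c∩ ⟩
    (r M (X ∪ Y) + r M (X ∩ Y)) + (c∪ + c∩)  ≤⟨ +-mono-≤ (r-submod X Y X⊆E Y⊆E) complements ⟩
    (r M X + r M Y) + (cX + cY)              ≡⟨ +-interchange (r M X) (r M Y) cX cY ⟩
    (r M X + cX) + (r M Y + cY)              ≡⟨ cong₂ _+_ (lam+rk≡r+r-complement X⊆E) (lam+rk≡r+r-complement Y⊆E) ⟨
    (lam M X + R) + (lam M Y + R)            ≡⟨ +-interchange (lam M X) R (lam M Y) R ⟩
    (lam M X + lam M Y) + (R + R)            ∎)
    where
    open ≤-Reasoning
    R = rk M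
    λ∪ = lam M (X ∪ Y)
    λ∩ = lam M (X ∩ Y)
    c∪ = r M (E M ─ (X ∪ Y))
    c∩ = r M (E M ─ (X ∩ Y))
    cX = r M (E M ─ X)
    cY = r M (E M ─ Y)
    X∪Y⊆E : X ∪ Y ⊆ E M
    X∪Y⊆E = ∪-lub X⊆E Y⊆E
    X∩Y⊆E : X ∩ Y ⊆ E M
    X∩Y⊆E = X⊆E ∘ p∩q⊆p X Y
    complements : c∪ + c∩ ≤ cX + cY
    complements = ≤-trans (≤-reflexive (+-comm c∪ c∩))
      (r-submod-⊆ (p─q⊆p (E M) X) (p─q⊆p (E M) Y) (p─q∩r⊆p─q∪p─r (E M) X Y) (p─q∪r⊆p─q∩p─r (E M) X Y))

  nonSkew-mono : ∀ {X Y Z} → X ⊆ Y → Y ⊆ E M → Z ⊆ E M → NonSkew M X Z → NonSkew M Y Z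
  nonSkew-mono {X} {Y} {Z} X⊆Y Y⊆E Z⊆E X∪Z<X+Z = +-cancelʳ-< (r M X) _ _ (begin-strict
    r M (Y ∪ Z) + r M X    ≤⟨ r-submod-⊆ (∪-lub (Y⊆E ∘ X⊆Y) Z⊆E) Y⊆E Y∪Z⊆ (∩-glb (p⊆p∪q Z) X⊆Y) ⟩
    r M (X ∪ Z) + r M Y    <⟨ +-monoˡ-< (r M Y) X∪Z<X+Z ⟩
    r M X + r M Z + r M Y  ≡⟨ rearrange (r M X) (r M Y) (r M Z) ⟩
    r M Y + r M Z + r M X  ∎)
    where
    open ≤-Reasoning
    Y∪Z⊆ : Y ∪ Z ⊆ (X ∪ Z) ∪ Y
    Y∪Z⊆ = ∪-lub (q⊆p∪q (X ∪ Z) Y) (⊆-trans (q⊆p∪q X Z) (p⊆p∪q Y))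
    rearrange : ∀ x y z → x + z + y ≡ y + z + x
    rearrange = solve-∀

  module _ {e : Fin n} (e∈E : e ∈ E M) where
    private
      re = r M ⁅ e ⁆
      ⁅e⁆⊆E : ⁅ e ⁆ ⊆ E M
      ⁅e⁆⊆E = x∈p⇒⁅x⁆⊆p e∈E

    r⁅e⁆≤1 : r M ⁅ e ⁆ ≤ 1
    r⁅e⁆≤1 = subst (re ≤_) (∣⁅x⁆∣≡1 e) (r-bound ⁅ e ⁆ ⁅e⁆⊆E)

    module _ {Y} (Y⊆E : Y ⊆ E M) (e∉Y : e ∉ Y) where
      private
        a = r M (Y ∪ ⁅ e ⁆)
        b = r M (E M ─ Y)
        R = rk M
        Y∪e⊆E : Y ∪ ⁅ e ⁆ ⊆ E M
        Y∪e⊆E = ∪-lub Y⊆E ⁅e⁆⊆E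
        e∈E─Y : e ∈ E M ─ Y
        e∈E─Y = x∈p∧x∉q⇒x∈p─q e∈E e∉Y
        λ′ = lam (contract M e) Y
        rY = r M Y

      lam-contract+rk : lam (contract M e) Y + rk M + r M ⁅ e ⁆ ≡ r M (Y ∪ ⁅ e ⁆) + r M (E M ─ Y)
      lam-contract+rk = begin
        (a ∸ re + (r M ((E M - e ─ Y) ∪ ⁅ e ⁆) ∸ re)) ∸ (r M ((E M - e) ∪ ⁅ e ⁆) ∸ re) + R + re
          ≡⟨ cong₂ (λ U V → (a ∸ re + (r M U ∸ re)) ∸ (r M V ∸ re) + R + re) E-e─Y∪e≡E─Y (p-x∪⁅x⁆≡p e∈E) ⟩
        (a ∸ re + (b ∸ re)) ∸ (R ∸ re) + R + re
          ≡⟨ [a∸c+b∸c]∸[d∸c]+d+c≡a+b (r-mono _ _ (q⊆p∪q Y ⁅ e ⁆) Y∪e⊆E) (r-mono _ _ (x∈p⇒⁅x⁆⊆p e∈E─Y) (p─q⊆p _ Y))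
               (r-mono _ _ ⁅e⁆⊆E ⊆-refl) R+re≤a+b ⟩
        a + b ∎
        where
        open ≡-Reasoning
        E-e─Y∪e≡E─Y : (E M - e ─ Y) ∪ ⁅ e ⁆ ≡ E M ─ Y
        E-e─Y∪e≡E─Y = trans (cong (_∪ ⁅ e ⁆) (p─q─r≡p─r─q (E M) ⁅ e ⁆ Y)) (p-x∪⁅x⁆≡p e∈E─Y)
        R+re≤a+b : R + re ≤ a + b
        R+re≤a+b = r-submod-⊆ Y∪e⊆E (p─q⊆p _ Y)
          (⊆-trans (q⊆p∪q─p Y (E M)) (∪-lub (⊆-trans (p⊆p∪q ⁅ e ⁆) (p⊆p∪q (E M ─ Y))) (q⊆p∪q (Y ∪ ⁅ e ⁆) _)))
          (∩-glb (q⊆p∪q Y ⁅ e ⁆) (x∈p⇒⁅x⁆⊆p e∈E─Y))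

      lam-contract-identity : lam (contract M e) Y + r M ⁅ e ⁆ + r M Y ≡ lam M Y + r M (Y ∪ ⁅ e ⁆)
      lam-contract-identity = +-cancelʳ-≡ (R + b) _ _ (begin
        λ′ + re + rY + (R + b)    ≡⟨ shuffle₁ λ′ re rY R b ⟩
        (λ′ + R + re) + (rY + b)  ≡⟨ cong₂ _+_ lam-contract+rk (sym (lam+rk≡r+r-complement Y⊆E)) ⟩
        (a + b) + (lam M Y + R)   ≡⟨ shuffle₂ a b (lam M Y) R ⟩
        lam M Y + a + (R + b)     ∎)
        where
        open ≡-Reasoning
        shuffle₁ : ∀ x c p R b → x + c + p + (R + b) ≡ (x + R + c) + (p + b)
        shuffle₁ = solve-∀
        shuffle₂ : ∀ a b y R → (a + b) + (y + R) ≡ y + a + (R + b)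
        shuffle₂ = solve-∀

      lam-contract≤lam : lam (contract M e) Y ≤ lam M Y
      lam-contract≤lam = +-cancelʳ-≤ (re + rY) λ′ (lam M Y) (begin
        λ′ + (re + rY)          ≡⟨ +-assoc λ′ re rY ⟨
        λ′ + re + rY            ≡⟨ lam-contract-identity ⟩
        lam M Y + a             ≤⟨ +-monoʳ-≤ (lam M Y) (≤-trans (m≤m+n a _) (r-submod Y ⁅ e ⁆ Y⊆E ⁅e⁆⊆E)) ⟩
        lam M Y + (rY + re)     ≡⟨ cong (lam M Y +_) (+-comm rY re) ⟩
        lam M Y + (re + rY)     ∎)
        where open ≤-Reasoning

      lam≤suc-lam-contract : lam M Y ≤ suc (lam (contract M e) Y)
      lam≤suc-lam-contract = begin
        lam M Y   ≤⟨ +-cancelʳ-≤ rY (lam M Y) (λ′ + re) (begin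
                       lam M Y + rY   ≤⟨ +-monoʳ-≤ (lam M Y) (r-mono _ _ (p⊆p∪q ⁅ e ⁆) Y∪e⊆E) ⟩
                       lam M Y + a    ≡⟨ lam-contract-identity ⟨
                       λ′ + re + rY   ∎) ⟩
        λ′ + re   ≤⟨ +-monoʳ-≤ λ′ r⁅e⁆≤1 ⟩
        λ′ + 1    ≡⟨ +-comm λ′ 1 ⟩
        suc λ′    ∎
        where open ≤-Reasoning

      lam-contract<lam⇔nonSkew : lam (contract M e) Y < lam M Y ⇔ NonSkew M Y ⁅ e ⁆
      lam-contract<lam⇔nonSkew = mk⇔ to from
        where
        open ≤-Reasoning
        to : λ′ < lam M Y → a < rY + re
        to λ′<λ = +-cancelˡ-< (lam M Y) a (rY + re) (begin-strict
          lam M Y + a         ≡⟨ lam-contract-identity ⟨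
          λ′ + re + rY        <⟨ +-monoˡ-< rY (+-monoˡ-< re λ′<λ) ⟩
          lam M Y + re + rY   ≡⟨ +-assoc (lam M Y) re rY ⟩
          lam M Y + (re + rY) ≡⟨ cong (lam M Y +_) (+-comm re rY) ⟩
          lam M Y + (rY + re) ∎)
        from : a < rY + re → λ′ < lam M Y
        from a<rY+re = +-cancelʳ-< (re + rY) λ′ (lam M Y) (begin-strict
          λ′ + (re + rY)      ≡⟨ +-assoc λ′ re rY ⟨
          λ′ + re + rY        ≡⟨ lam-contract-identity ⟩
          lam M Y + a         <⟨ +-monoʳ-< (lam M Y) a<rY+re ⟩
          lam M Y + (rY + re) ≡⟨ cong (lam M Y +_) (+-comm rY re) ⟩
          lam M Y + (re + rY) ∎)

    kappa-contract<⇒nonSkew-separating : ∀ {S T W} → Separating (contract M e) S T W →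
      kappa (contract M e) S T < kappa M S T →
      ∃ λ X → Separating M S T X × e ∉ X × lam M X ≤ kappa M S T × NonSkew M X ⁅ e ⁆
    kappa-contract<⇒nonSkew-separating {S} {T} W-sep′ κ′<κ with kappa-attained (contract M e) S T W-sep′
    ... | X , X-sep′ , λ′X≡κ′ with separating-contract⁻ X-sep′
    ... | X-sep , e∉X =
      X , X-sep , e∉X , ≤-trans (lam≤suc-lam-contract X⊆E e∉X) λ′X<κ ,
      Equivalence.to (lam-contract<lam⇔nonSkew X⊆E e∉X) (<-≤-trans λ′X<κ (kappa-≤-lam M S T X-sep))
      where
      X⊆E : X ⊆ E M
      X⊆E = separating⇒⊆E X-sep
      λ′X<κ : lam (contract M e) X < kappa M S T
      λ′X<κ = subst (_< kappa M S T) (sym λ′X≡κ′) κ′<κ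

  lam-∪≤kappa : ∀ {S T X Y} → Separating M S T X → Separating M S T Y →
                lam M X ≤ kappa M S T → lam M Y ≤ kappa M S T → lam M (X ∪ Y) ≤ kappa M S T
  lam-∪≤kappa {S} {T} {X} {Y} X-sep Y-sep λX≤κ λY≤κ = +-cancelʳ-≤ κ _ κ (begin
    lam M (X ∪ Y) + κ              ≤⟨ +-monoʳ-≤ (lam M (X ∪ Y)) (kappa-≤-lam M S T (separating-∩ X-sep Y-sep)) ⟩
    lam M (X ∪ Y) + lam M (X ∩ Y)  ≤⟨ lam-submodular (separating⇒⊆E X-sep) (separating⇒⊆E Y-sep) ⟩
    lam M X + lam M Y              ≤⟨ +-mono-≤ λX≤κ λY≤κ ⟩
    κ + κ                          ∎)
    where
    open ≤-Reasoning
    κ = kappa M S T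

lemma3p6 : ∀ {n} (M : RankData n) → IsMatroid M →
  (S T : Subset n) → S ⊆ E M → T ⊆ E M → Empty (S ∩ T) →
  (k : ℕ) → k ≡ kappa M S T →
  (U : Subset n) → U ⊆ E M → IsSTSeparatingOfOrder M S T U (suc k) →
  (e : Fin n) → e ∈ E M → e ∉ (T ∪ U) →
  kappa (contract M e) S T ≢ kappa M S T →
  kappa (contract M e) U T ≢ kappa M U T
lemma3p6 M isMatroid S T _ _ _ _ refl U U⊆E (S⊆U , U∩T≡∅ , suc-λU≡suc-κ) e e∈E e∉T∪U κ′≢κ =
  let X , X-sep , e∉X , λX≤κ , X-nonSkew = kappa-contract<⇒nonSkew-separating isMatroid e∈E U-sep′ κ′<κ
      X∪U⊆E = ∪-lub (separating⇒⊆E X-sep) U⊆E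
      e∉X∪U = [ e∉X , e∉U ]′ ∘ x∈p∪q⁻ X U
      X∪U-nonSkew = nonSkew-mono isMatroid (p⊆p∪q U) X∪U⊆E (x∈p⇒⁅x⁆⊆p e∈E) X-nonSkew
      X∪U-sep′ = separating-∪ (Separating.⊆E─T (separating-contract⁺ X-sep e∉X)) (separating-self U-sep′)
  in <⇒≢ (begin-strict
    kappa (contract M e) U T    ≤⟨ kappa-≤-lam (contract M e) U T X∪U-sep′ ⟩
    lam (contract M e) (X ∪ U)  <⟨ Equivalence.from (lam-contract<lam⇔nonSkew isMatroid e∈E X∪U⊆E e∉X∪U) X∪U-nonSkew ⟩
    lam M (X ∪ U)               ≤⟨ lam-∪≤kappa isMatroid X-sep U-sep λX≤κ (≤-reflexive λU≡κ) ⟩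
    kappa M S T                 ≤⟨ kappa-mono M S⊆U (separating-self U-sep) ⟩
    kappa M U T                 ∎)
  where
  open ≤-Reasoning
  e∉U : e ∉ U
  e∉U = e∉T∪U ∘ x∈p∪q⁺ ∘ inj₂
  λU≡κ : lam M U ≡ kappa M S T
  λU≡κ = suc-injective suc-λU≡suc-κ
  U-sep : Separating M S T U
  U-sep = disjoint⇒separating S⊆U U⊆E U∩T≡∅
  U-sep′ : Separating (contract M e) S T U
  U-sep′ = separating-contract⁺ U-sep e∉U
  κ′<κ : kappa (contract M e) S T < kappa M S T
  κ′<κ = ≤∧≢⇒< (≤-trans (kappa-≤-lam (contract M e) S T U-sep′)
                         (≤-trans (lam-contract≤lam isMatroid e∈E U⊆E e∉U) (≤-reflexive λU≡κ))) κ′≢κ
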